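{- Let $G$ be a niche-realizable graph. Then $G$ is chordal if and only if one of the following holds: (1) $G$ has exactly three or exactly four components, each of which is complete; (2) $G$ has exactly two components, each of which is a complete graph or an expansion of a path of length two.
   Context: All graphs are simple. A bipartite tournament is an orientation of a complete bipartite graph. The niche graph of a digraph $D$ is the graph with vertex set $V(D)$ in which distinct $u,v$ are adjacent iff there is a vertex $w$ with $(u,w),(v,w)\in A(D)$, or with $(w,u),(w,v)\in A(D)$. A graph is niche-realizable if it is the niche graph of some bipartite tournament. Replacing a vertex $v$ of $H$ with a clique formed by a finite set $K$ disjoint from $V(H)$ gives the graph with vertex set $(V(H)\cup K)\setminus\{v\}$ and edge set $E(H-v)\cup\{wx: w\neq x,\ w,x\in K\}\cup\{uw: uv\in E(H), w\in K\}$; an expansion of $H$ is a graph obtained by replacing each vertex of $H$ with a clique (possibly of size one). A path of length two is the path with three vertices and two edges. -}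

module Defs where

open import Data.Nat using (ℕ; zero; suc; _≤_; _∸_)
open import Data.Fin using (Fin; toℕ) renaming (zero to f0; suc to fs)
open import Data.Bool using (Bool; true; false)
open import Data.Product using (Σ; ∃; ∃-syntax; _×_; _,_)
open import Data.Sum using (_⊎_)
open import Data.Empty using (⊥)
open import Data.Unit using (⊤)
open import Relation.Nullary using (¬_)
open import Relation.Binary.PropositionalEquality using (_≡_; _≢_)
open import Relation.Binary.Construct.Closure.ReflexiveTransitive using (Star)
open import Function.Definitions using (Injective)
open import Function.Bundles using (_⇔_)

record Graph (n : ℕ) : Set₁ where
  field
    Adj    : Fin n → Fin n → Set
    sym    : ∀ {u v} → Adj u v → Adj v u
    irrefl : ∀ {u} → ¬ Adj u u
open Graph public

record Digraph (n : ℕ) : Set₁ where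
  field
    Arc : Fin n → Fin n → Set
open Digraph public

record IsBipartiteTournament {n : ℕ} (D : Digraph n) : Set where
  field
    side        : Fin n → Bool
    partFalse   : ∃[ v ] side v ≡ false
    partTrue    : ∃[ v ] side v ≡ true
    noArcInside : ∀ u v → side u ≡ side v → ¬ Arc D u v
    oriented    : ∀ u v → side u ≢ side v → Arc D u v ⊎ Arc D v u
    antisym     : ∀ u v → Arc D u v → ¬ Arc D v u

NicheAdj : ∀ {n} → Digraph n → Fin n → Fin n → Set
NicheAdj D u v =
  u ≢ v × (∃[ w ] ((Arc D u w × Arc D v w) ⊎ (Arc D w u × Arc D w v)))

IsNicheGraphOf : ∀ {n} → Graph n → Digraph n → Set
IsNicheGraphOf G D = ∀ u v → Adj G u v ⇔ NicheAdj D u v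

NicheRealizable : ∀ {n} → Graph n → Set₁
NicheRealizable {n} G =
  Σ (Digraph n) λ D → IsBipartiteTournament D × IsNicheGraphOf G D

Consec : (k : ℕ) → Fin k → Fin k → Set
Consec k i j = (toℕ j ≡ suc (toℕ i)) ⊎ ((toℕ i ≡ k ∸ 1) × (toℕ j ≡ 0))

IsCycle : ∀ {n} → Graph n → (k : ℕ) → (Fin k → Fin n) → Set
IsCycle G k c =
  (3 ≤ k) × Injective _≡_ _≡_ c × (∀ i j → Consec k i j → Adj G (c i) (c j))

HasChord : ∀ {n} → Graph n → (k : ℕ) → (Fin k → Fin n) → Set
HasChord G k c =
  ∃[ i ] ∃[ j ] (Adj G (c i) (c j) × ¬ Consec k i j × ¬ Consec k j i)

Chordal : ∀ {n} → Graph n → Set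
Chordal {n} G =
  ∀ k → 4 ≤ k → (c : Fin k → Fin n) → IsCycle G k c → HasChord G k c

Reachable : ∀ {n} → Graph n → Fin n → Fin n → Set
Reachable G = Star (Adj G)

-- comp labels the connected components of G bijectively by Fin m,
-- i.e. G has exactly m components.
IsComponentLabelling : ∀ {n} → Graph n → (m : ℕ) → (Fin n → Fin m) → Set
IsComponentLabelling G m comp =
  (∀ i → ∃[ v ] comp v ≡ i) × (∀ u v → (comp u ≡ comp v) ⇔ Reachable G u v)

CompleteOn : ∀ {n} → Graph n → (Fin n → Set) → Set
CompleteOn G S = ∀ u v → S u → S v → u ≢ v → Adj G u v

-- the subgraph induced on S is an expansion of H: S is partitioned into
-- nonempty cliques f⁻¹(t), t ∈ V(H), and vertices in distinct cliques
-- are adjacent iff the corresponding vertices of H are adjacent.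
ExpansionOn : ∀ {n m} → Graph n → (Fin n → Set) → Graph m → Set
ExpansionOn {n} {m} G S H =
  Σ (Fin n → Fin m) λ f →
    (∀ t → ∃[ v ] (S v × f v ≡ t)) ×
    (∀ u v → S u → S v → u ≢ v → Adj G u v ⇔ (f u ≡ f v ⊎ Adj H (f u) (f v)))

P3Adj : Fin 3 → Fin 3 → Set
P3Adj f0 (fs f0) = ⊤
P3Adj (fs f0) f0 = ⊤
P3Adj (fs f0) (fs (fs f0)) = ⊤
P3Adj (fs (fs f0)) (fs f0) = ⊤
P3Adj _ _ = ⊥

P3 : Graph 3
P3 = record { Adj = P3Adj ; sym = s ; irrefl = ir }
  where
  s : ∀ {u v} → P3Adj u v → P3Adj v u
  s {f0} {fs f0} p = _
  s {fs f0} {f0} p = _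
  s {fs f0} {fs (fs f0)} p = _
  s {fs (fs f0)} {fs f0} p = _
  ir : ∀ {u} → ¬ P3Adj u u
  ir {f0} ()
  ir {fs f0} ()
  ir {fs (fs f0)} ()

Alternative1 : ∀ {n} → Graph n → Set
Alternative1 {n} G =
  ∃[ m ] ((m ≡ 3 ⊎ m ≡ 4) ×
    Σ (Fin n → Fin m) λ comp →
      IsComponentLabelling G m comp × (∀ i → CompleteOn G (λ v → comp v ≡ i)))

Alternative2 : ∀ {n} → Graph n → Set
Alternative2 {n} G =
  Σ (Fin n → Fin 2) λ comp →
    IsComponentLabelling G 2 comp ×
    (∀ i → CompleteOn G (λ v → comp v ≡ i) ⊎ ExpansionOn G (λ v → comp v ≡ i) P3)

-- In the niche graph of a bipartite tournament, edges only join vertices of the same part, and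
-- two vertices of a part are non-adjacent exactly when their out-neighbourhoods in the other
-- part (their profiles) are complementary. Suppose the graph is chordal and a part is not a
-- clique, witnessed by a non-adjacent pair a, b. A vertex c whose profile is neither that of a
-- nor that of b is adjacent to a and b, and to every other vertex d of the part: otherwise d has
-- the profile complementary to c, and a c b d is a chordless 4-cycle. So the part induces an
-- expansion of P3 (profile of a, the rest, profile of b) or, if there is no such c, two cliques
-- with complementary profiles. In the latter case any two vertices of the other part have equal
-- or complementary profiles, which excludes a P3-expansion there. Collecting the cliques gives
-- alternatives (1) and (2). Conversely, a cycle of length at least 4 lies in one component, and
-- in a clique or a P3-expansion one of the pairs (c₀, c₂), (c₁, c₃) of the cycle is adjacent.

module Submission where

open import Level using (0ℓ)
open import Data.Nat using (ℕ; suc; _+_; s≤s; z≤n)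
open import Data.Nat.Properties using (<-irrefl)
open import Data.Fin using (Fin; splitAt; join) renaming (_≟_ to _≟ᶠ_)
open import Data.Fin.Patterns using (0F; 1F; 2F; 3F)
open import Data.Bool using (Bool; true; false; not) renaming (_≟_ to _≟ᵇ_)
open import Data.Bool.Properties using (not-involutive; not-¬; ¬-not)
open import Data.Fin.Properties using (toℕ-injective; toℕ<n; splitAt-join; join-splitAt; any?; all?)
open import Data.Product using (Σ; ∃; ∃-syntax; _×_; _,_; proj₁; proj₂)
open import Data.Sum using (_⊎_; inj₁; inj₂; [_,_])
open import Data.Empty using (⊥; ⊥-elim)
open import Data.Unit using (tt)
open import Relation.Unary using (Pred; _≐_)
open import Relation.Nullary using (¬_; Dec; yes; no; does)
open import Relation.Nullary.Decidable
  using (map′; decidable-stable; dec-true; dec-false; _×-dec_; _⊎-dec_; _→-dec_; ¬?)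
open import Relation.Binary.PropositionalEquality
  using (_≡_; _≢_; refl; sym; trans; cong; subst; subst₂; ≢-sym; module ≡-Reasoning)
open import Relation.Binary.Construct.Closure.ReflexiveTransitive using (ε; _◅_; _◅◅_; fold)
open import Function.Bundles using (_⇔_; mk⇔; Equivalence)
open Equivalence using (to; from)

open import Defs renaming (sym to adj-sym)

-- Reachability and 4-cycles

module _ {n : ℕ} (G : Graph n) where

  adjacent⇒≢ : ∀ {u v} → Adj G u v → u ≢ v
  adjacent⇒≢ e refl = irrefl G e

  reachable-preserves : ∀ {X : Set} (h : Fin n → X) → (∀ {u v} → Adj G u v → h u ≡ h v) →
                        ∀ {u v} → Reachable G u v → h u ≡ h v
  reachable-preserves h h-adj = fold (λ u v → h u ≡ h v) (λ e → trans (h-adj e)) refl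

  reachable-if-adjacent-or-equal : ∀ {u v} → (u ≢ v → Adj G u v) → Reachable G u v
  reachable-if-adjacent-or-equal {u} {v} adj with u ≟ᶠ v
  ... | yes refl = ε
  ... | no u≢v = adj u≢v ◅ ε

  module Square {x₀ x₁ x₂ x₃ : Fin n} (x₀≢x₂ : x₀ ≢ x₂) (x₁≢x₃ : x₁ ≢ x₃)
    (e₀₁ : Adj G x₀ x₁) (e₁₂ : Adj G x₁ x₂) (e₂₃ : Adj G x₂ x₃) (e₃₀ : Adj G x₃ x₀) where

    square : Fin 4 → Fin n
    square 0F = x₀
    square 1F = x₁
    square 2F = x₂
    square 3F = x₃

    square-injective : ∀ {i j} → square i ≡ square j → i ≡ j
    square-injective {0F} {0F} _ = refl
    square-injective {1F} {1F} _ = refl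
    square-injective {2F} {2F} _ = refl
    square-injective {3F} {3F} _ = refl
    square-injective {0F} {1F} p = ⊥-elim (adjacent⇒≢ e₀₁ p)
    square-injective {1F} {2F} p = ⊥-elim (adjacent⇒≢ e₁₂ p)
    square-injective {2F} {3F} p = ⊥-elim (adjacent⇒≢ e₂₃ p)
    square-injective {3F} {0F} p = ⊥-elim (adjacent⇒≢ e₃₀ p)
    square-injective {1F} {0F} p = ⊥-elim (adjacent⇒≢ e₀₁ (sym p))
    square-injective {2F} {1F} p = ⊥-elim (adjacent⇒≢ e₁₂ (sym p))
    square-injective {3F} {2F} p = ⊥-elim (adjacent⇒≢ e₂₃ (sym p))
    square-injective {0F} {3F} p = ⊥-elim (adjacent⇒≢ e₃₀ (sym p))
    square-injective {0F} {2F} p = ⊥-elim (x₀≢x₂ p)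
    square-injective {2F} {0F} p = ⊥-elim (x₀≢x₂ (sym p))
    square-injective {1F} {3F} p = ⊥-elim (x₁≢x₃ p)
    square-injective {3F} {1F} p = ⊥-elim (x₁≢x₃ (sym p))

    square-consecutive : ∀ i j → Consec 4 i j → Adj G (square i) (square j)
    square-consecutive 0F j (inj₁ j≡1) rewrite toℕ-injective {j = 1F} j≡1 = e₀₁
    square-consecutive 1F j (inj₁ j≡2) rewrite toℕ-injective {j = 2F} j≡2 = e₁₂
    square-consecutive 2F j (inj₁ j≡3) rewrite toℕ-injective {j = 3F} j≡3 = e₂₃
    square-consecutive 3F j (inj₁ j≡4) = ⊥-elim (<-irrefl j≡4 (toℕ<n j))
    square-consecutive 3F j (inj₂ (_ , j≡0)) rewrite toℕ-injective {j = 0F} j≡0 = e₃₀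
    square-consecutive 0F _ (inj₂ (() , _))
    square-consecutive 1F _ (inj₂ (() , _))
    square-consecutive 2F _ (inj₂ (() , _))

    chord⇒diagonal : HasChord G 4 square → Adj G x₀ x₂ ⊎ Adj G x₁ x₃
    chord⇒diagonal (0F , 2F , e , _) = inj₁ e
    chord⇒diagonal (2F , 0F , e , _) = inj₁ (adj-sym G e)
    chord⇒diagonal (1F , 3F , e , _) = inj₂ e
    chord⇒diagonal (3F , 1F , e , _) = inj₂ (adj-sym G e)
    chord⇒diagonal (0F , 0F , e , _) = ⊥-elim (irrefl G e)
    chord⇒diagonal (1F , 1F , e , _) = ⊥-elim (irrefl G e)
    chord⇒diagonal (2F , 2F , e , _) = ⊥-elim (irrefl G e)
    chord⇒diagonal (3F , 3F , e , _) = ⊥-elim (irrefl G e)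
    chord⇒diagonal (0F , 1F , _ , ¬c , _) = ⊥-elim (¬c (inj₁ refl))
    chord⇒diagonal (1F , 2F , _ , ¬c , _) = ⊥-elim (¬c (inj₁ refl))
    chord⇒diagonal (2F , 3F , _ , ¬c , _) = ⊥-elim (¬c (inj₁ refl))
    chord⇒diagonal (3F , 0F , _ , ¬c , _) = ⊥-elim (¬c (inj₂ (refl , refl)))
    chord⇒diagonal (1F , 0F , _ , _ , ¬c) = ⊥-elim (¬c (inj₁ refl))
    chord⇒diagonal (2F , 1F , _ , _ , ¬c) = ⊥-elim (¬c (inj₁ refl))
    chord⇒diagonal (3F , 2F , _ , _ , ¬c) = ⊥-elim (¬c (inj₁ refl))
    chord⇒diagonal (0F , 3F , _ , _ , ¬c) = ⊥-elim (¬c (inj₂ (refl , refl)))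

  chordal⇒square-has-diagonal : Chordal G → ∀ {x₀ x₁ x₂ x₃} → x₀ ≢ x₂ → x₁ ≢ x₃ →
    Adj G x₀ x₁ → Adj G x₁ x₂ → Adj G x₂ x₃ → Adj G x₃ x₀ → Adj G x₀ x₂ ⊎ Adj G x₁ x₃
  chordal⇒square-has-diagonal chordal x₀≢x₂ x₁≢x₃ e₀₁ e₁₂ e₂₃ e₃₀ =
    chord⇒diagonal (chordal 4 (s≤s (s≤s (s≤s (s≤s z≤n)))) square
                     (s≤s (s≤s (s≤s z≤n)) , square-injective , square-consecutive))
    where open Square x₀≢x₂ x₁≢x₃ e₀₁ e₁₂ e₂₃ e₃₀

-- Cliques and expansions of P3

ReflP3Adj : Fin 3 → Fin 3 → Set
ReflP3Adj t t′ = t ≡ t′ ⊎ P3Adj t t′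

ReflP3Adj-sym : ∀ {t t′} → ReflP3Adj t t′ → ReflP3Adj t′ t
ReflP3Adj-sym (inj₁ t≡t′) = inj₁ (sym t≡t′)
ReflP3Adj-sym (inj₂ a) = inj₂ (adj-sym P3 a)

ReflP3Adj-middle : ∀ t → ReflP3Adj 1F t
ReflP3Adj-middle 0F = inj₂ tt
ReflP3Adj-middle 1F = inj₁ refl
ReflP3Adj-middle 2F = inj₂ tt

¬ReflP3Adj-ends : ¬ ReflP3Adj 0F 2F
¬ReflP3Adj-ends (inj₁ ())
¬ReflP3Adj-ends (inj₂ ())

ReflP3Adj-trans-or-middle : ∀ {t₀ t₁ t₂} → ReflP3Adj t₀ t₁ → ReflP3Adj t₁ t₂ →
                            ReflP3Adj t₀ t₂ ⊎ t₁ ≡ 1F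
ReflP3Adj-trans-or-middle {t₁ = 1F} _ _ = inj₂ refl
ReflP3Adj-trans-or-middle {0F} {0F} _ r₁₂ = inj₁ r₁₂
ReflP3Adj-trans-or-middle {2F} {2F} _ r₁₂ = inj₁ r₁₂
ReflP3Adj-trans-or-middle {1F} {_} {t₂} _ _ = inj₁ (ReflP3Adj-middle t₂)
ReflP3Adj-trans-or-middle {0F} {2F} r₀₁ _ = ⊥-elim (¬ReflP3Adj-ends r₀₁)
ReflP3Adj-trans-or-middle {2F} {0F} r₀₁ _ = ⊥-elim (¬ReflP3Adj-ends (ReflP3Adj-sym r₀₁))

CompleteOrP3ExpansionOn : ∀ {n} → Graph n → Pred (Fin n) 0ℓ → Set
CompleteOrP3ExpansionOn G S = CompleteOn G S ⊎ ExpansionOn G S P3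

module _ {n : ℕ} (G : Graph n) where

  CompleteOn-resp : ∀ {S S′} → S ≐ S′ → CompleteOn G S → CompleteOn G S′
  CompleteOn-resp (_ , S′⊆S) complete u v su sv = complete u v (S′⊆S su) (S′⊆S sv)

  ExpansionOn-resp : ∀ {m} {H : Graph m} {S S′} → S ≐ S′ → ExpansionOn G S H → ExpansionOn G S′ H
  ExpansionOn-resp (S⊆S′ , S′⊆S) (f , f-onto , f-adj) =
    f , (λ t → let (v , sv , fv≡t) = f-onto t in v , S⊆S′ sv , fv≡t) ,
    λ u v su sv → f-adj u v (S′⊆S su) (S′⊆S sv)

  CompleteOrP3ExpansionOn-resp : ∀ {S S′} → S ≐ S′ →
    CompleteOrP3ExpansionOn G S → CompleteOrP3ExpansionOn G S′
  CompleteOrP3ExpansionOn-resp S≐S′ (inj₁ complete) = inj₁ (CompleteOn-resp S≐S′ complete)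
  CompleteOrP3ExpansionOn-resp S≐S′ (inj₂ expansion) = inj₂ (ExpansionOn-resp {H = P3} S≐S′ expansion)

  CompleteOn-connected : ∀ {S u v} → CompleteOn G S → S u → S v → Reachable G u v
  CompleteOn-connected complete su sv = reachable-if-adjacent-or-equal G (complete _ _ su sv)

  module P3Expansion {S : Pred (Fin n) 0ℓ} (expansion : ExpansionOn G S P3) where

    f : Fin n → Fin 3
    f = proj₁ expansion

    adjacent⇔ : ∀ {u v} → S u → S v → u ≢ v → Adj G u v ⇔ ReflP3Adj (f u) (f v)
    adjacent⇔ su sv u≢v = proj₂ (proj₂ expansion) _ _ su sv u≢v

    vertex-labelled : ∀ t → ∃[ v ] (S v × f v ≡ t)
    vertex-labelled = proj₁ (proj₂ expansion)

    middle-ReflP3Adj : ∀ {m} → f m ≡ 1F → ∀ w → ReflP3Adj (f m) (f w)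
    middle-ReflP3Adj fm≡1 w = subst (λ t → ReflP3Adj t (f w)) (sym fm≡1) (ReflP3Adj-middle (f w))

    connected : ∀ {u v} → S u → S v → Reachable G u v
    connected {u} {v} su sv with vertex-labelled 1F
    ... | m , sm , fm≡1 =
      reachable-if-adjacent-or-equal G
        (λ u≢m → from (adjacent⇔ su sm u≢m) (ReflP3Adj-sym (middle-ReflP3Adj fm≡1 u)))
      ◅◅ reachable-if-adjacent-or-equal G
        (λ m≢v → from (adjacent⇔ sm sv m≢v) (middle-ReflP3Adj fm≡1 v))

    square-has-diagonal : ∀ {x₀ x₁ x₂ x₃} → S x₀ → S x₁ → S x₂ → S x₃ →
      Adj G x₀ x₁ → Adj G x₁ x₂ → x₀ ≢ x₂ → x₁ ≢ x₃ → Adj G x₀ x₂ ⊎ Adj G x₁ x₃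
    square-has-diagonal {x₀} {x₁} {x₂} {x₃} s₀ s₁ s₂ s₃ e₀₁ e₁₂ x₀≢x₂ x₁≢x₃
      with ReflP3Adj-trans-or-middle (to (adjacent⇔ s₀ s₁ (adjacent⇒≢ G e₀₁)) e₀₁)
                                     (to (adjacent⇔ s₁ s₂ (adjacent⇒≢ G e₁₂)) e₁₂)
    ... | inj₁ r₀₂ = inj₁ (from (adjacent⇔ s₀ s₂ x₀≢x₂) r₀₂)
    ... | inj₂ f₁≡1 = inj₂ (from (adjacent⇔ s₁ s₃ x₁≢x₃) (middle-ReflP3Adj f₁≡1 x₃))

    ¬adjacency-transitive :
      ¬ (∀ {a b c} → S a → S b → S c → Adj G a b → Adj G b c → a ≢ c → Adj G a c)
    ¬adjacency-transitive transitive with vertex-labelled 0F | vertex-labelled 1F | vertex-labelled 2F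
    ... | a , sa , fa≡0 | b , sb , fb≡1 | c , sc , fc≡2 =
      ¬ReflP3Adj-ends (subst₂ ReflP3Adj fa≡0 fc≡2 (to (adjacent⇔ sa sc a≢c) a~c))
      where
      labels-differ : ∀ {u v t t′} → f u ≡ t → f v ≡ t′ → t ≢ t′ → u ≢ v
      labels-differ fu≡t fv≡t′ t≢t′ refl = t≢t′ (trans (sym fu≡t) fv≡t′)
      a≢c : a ≢ c
      a≢c = labels-differ fa≡0 fc≡2 (λ ())
      ab : Adj G a b
      ab = from (adjacent⇔ sa sb (labels-differ fa≡0 fb≡1 (λ ())))
                (subst₂ ReflP3Adj (sym fa≡0) (sym fb≡1) (inj₂ tt))
      bc : Adj G b c
      bc = from (adjacent⇔ sb sc (labels-differ fb≡1 fc≡2 (λ ())))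
                (subst₂ ReflP3Adj (sym fb≡1) (sym fc≡2) (inj₂ tt))
      a~c : Adj G a c
      a~c = transitive sa sb sc ab bc a≢c

  CompleteOrP3ExpansionOn-connected : ∀ {S u v} → CompleteOrP3ExpansionOn G S →
                                      S u → S v → Reachable G u v
  CompleteOrP3ExpansionOn-connected (inj₁ complete) = CompleteOn-connected complete
  CompleteOrP3ExpansionOn-connected (inj₂ expansion) = P3Expansion.connected expansion

  CompleteOrP3ExpansionOn-square-has-diagonal : ∀ {S x₀ x₁ x₂ x₃} → CompleteOrP3ExpansionOn G S →
    S x₀ → S x₁ → S x₂ → S x₃ →
    Adj G x₀ x₁ → Adj G x₁ x₂ → x₀ ≢ x₂ → x₁ ≢ x₃ → Adj G x₀ x₂ ⊎ Adj G x₁ x₃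
  CompleteOrP3ExpansionOn-square-has-diagonal (inj₁ complete) s₀ _ s₂ _ _ _ x₀≢x₂ _ =
    inj₁ (complete _ _ s₀ s₂ x₀≢x₂)
  CompleteOrP3ExpansionOn-square-has-diagonal (inj₂ expansion) =
    P3Expansion.square-has-diagonal expansion

  chordal-if-components-complete-or-P3-expansions : ∀ {m comp} → IsComponentLabelling G m comp →
    (∀ i → CompleteOrP3ExpansionOn G (λ v → comp v ≡ i)) → Chordal G
  chordal-if-components-complete-or-P3-expansions {comp = comp} (_ , same⇔reachable) shape
    (suc (suc (suc (suc k)))) (s≤s (s≤s (s≤s (s≤s _)))) c (_ , c-injective , c-consecutive) =
    chord (CompleteOrP3ExpansionOn-square-has-diagonal (shape (comp (c 0F))) refl s₁ s₂ s₃
            e₀₁ e₁₂ (distinct (λ ())) (distinct (λ ())))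
    where
    K : ℕ
    K = suc (suc (suc (suc k)))
    adjacent⇒same-component : ∀ {u v} → Adj G u v → comp u ≡ comp v
    adjacent⇒same-component e = from (same⇔reachable _ _) (e ◅ ε)
    e₀₁ : Adj G (c 0F) (c 1F)
    e₀₁ = c-consecutive 0F 1F (inj₁ refl)
    e₁₂ : Adj G (c 1F) (c 2F)
    e₁₂ = c-consecutive 1F 2F (inj₁ refl)
    s₁ : comp (c 1F) ≡ comp (c 0F)
    s₁ = sym (adjacent⇒same-component e₀₁)
    s₂ : comp (c 2F) ≡ comp (c 0F)
    s₂ = trans (sym (adjacent⇒same-component e₁₂)) s₁
    s₃ : comp (c 3F) ≡ comp (c 0F)
    s₃ = trans (sym (adjacent⇒same-component (c-consecutive 2F 3F (inj₁ refl)))) s₂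
    distinct : ∀ {i j} → i ≢ j → c i ≢ c j
    distinct i≢j ci≡cj = i≢j (c-injective ci≡cj)
    chord : Adj G (c 0F) (c 2F) ⊎ Adj G (c 1F) (c 3F) → HasChord G K c
    chord (inj₁ e) =
      0F , 2F , e , (λ { (inj₁ ()) ; (inj₂ (() , _)) }) , (λ { (inj₁ ()) ; (inj₂ (() , _)) })
    chord (inj₂ e) =
      1F , 3F , e , (λ { (inj₁ ()) ; (inj₂ (() , _)) }) , (λ { (inj₁ ()) ; (inj₂ (_ , ())) })

  alternatives⇒chordal : Alternative1 G ⊎ Alternative2 G → Chordal G
  alternatives⇒chordal (inj₁ (_ , _ , _ , labelling , cliques)) =
    chordal-if-components-complete-or-P3-expansions labelling (λ i → inj₁ (cliques i))
  alternatives⇒chordal (inj₂ (_ , labelling , shape)) =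
    chordal-if-components-complete-or-P3-expansions labelling shape

-- Component labellings

record Partition {n} (G : Graph n) (S : Pred (Fin n) 0ℓ) (k : ℕ) (P : Pred (Fin n) 0ℓ → Set) :
                 Set where
  field
    label      : Fin n → Fin k
    label-onto : ∀ i → ∃[ v ] (S v × label v ≡ i)
    label-adj  : ∀ {u v} → S u → Adj G u v → label u ≡ label v
    class      : ∀ i → P (λ v → S v × label v ≡ i)

join≡⇔≡splitAt : ∀ p q {x : Fin p ⊎ Fin q} {i : Fin (p + q)} → join p q x ≡ i ⇔ x ≡ splitAt p i
join≡⇔≡splitAt p q {x} {i} =
  mk⇔ (λ join≡i → trans (sym (splitAt-join p q x)) (cong (splitAt p) join≡i))
      (λ x≡split → trans (cong (join p q) x≡split) (join-splitAt p q i))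

single-part : ∀ {n} (G : Graph n) {P : Pred (Fin n) 0ℓ → Set} →
              (∀ {S S′} → S ≐ S′ → P S → P S′) → ∀ {S} → ∃ S → P S → Partition G S 1 P
single-part G P-resp (v , sv) PS = record
  { label = λ _ → 0F
  ; label-onto = λ { 0F → v , sv , refl }
  ; label-adj = λ _ _ → refl
  ; class = λ { 0F → P-resp ((λ su → su , refl) , proj₁) PS }
  }

module _ {n : ℕ} (G : Graph n) {P : Pred (Fin n) 0ℓ → Set}
  (P-resp : ∀ {S S′} → S ≐ S′ → P S → P S′)
  (P-connected : ∀ {S u v} → P S → S u → S v → Reachable G u v) where

  labelling-by-connected-classes : ∀ {m} (ℓ : Fin n → Fin m) → (∀ i → ∃[ v ] ℓ v ≡ i) →
    (∀ {u v} → Adj G u v → ℓ u ≡ ℓ v) → (∀ i → P (λ v → ℓ v ≡ i)) → IsComponentLabelling G m ℓ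
  labelling-by-connected-classes ℓ onto ℓ-adj class =
    onto , λ u v →
      mk⇔ (λ ℓu≡ℓv → P-connected (class (ℓ v)) ℓu≡ℓv refl) (reachable-preserves G ℓ ℓ-adj)

  module Union (s : Fin n → Bool) (s-adj : ∀ {u v} → Adj G u v → s u ≡ s v) {p q : ℕ}
    (F : Partition G (λ v → s v ≡ false) p P) (T : Partition G (λ v → s v ≡ true) q P) where
    private
      module F = Partition F
      module T = Partition T

    sideLabel : Fin n → Fin p ⊎ Fin q
    sideLabel v with s v
    ... | false = inj₁ (F.label v)
    ... | true = inj₂ (T.label v)

    sideLabel≡inj₁⇔ : ∀ {v j} → sideLabel v ≡ inj₁ j ⇔ (s v ≡ false × F.label v ≡ j)
    sideLabel≡inj₁⇔ {v} with s v
    ... | false = mk⇔ (λ { refl → refl , refl }) (λ { (_ , refl) → refl })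
    ... | true = mk⇔ (λ ()) (λ { (() , _) })

    sideLabel≡inj₂⇔ : ∀ {v j} → sideLabel v ≡ inj₂ j ⇔ (s v ≡ true × T.label v ≡ j)
    sideLabel≡inj₂⇔ {v} with s v
    ... | false = mk⇔ (λ ()) (λ { (() , _) })
    ... | true = mk⇔ (λ { refl → refl , refl }) (λ { (_ , refl) → refl })

    sideLabel-onto : ∀ x → ∃[ v ] sideLabel v ≡ x
    sideLabel-onto (inj₁ j) =
      let (v , sv , ℓv) = F.label-onto j in v , from sideLabel≡inj₁⇔ (sv , ℓv)
    sideLabel-onto (inj₂ j) =
      let (v , sv , ℓv) = T.label-onto j in v , from sideLabel≡inj₂⇔ (sv , ℓv)

    sideLabel-adj : ∀ {u v} → Adj G u v → sideLabel u ≡ sideLabel v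
    sideLabel-adj {u} {v} e with s u in su | s v | s-adj e
    ... | false | false | _ = cong inj₁ (F.label-adj su e)
    ... | true  | true  | _ = cong inj₂ (T.label-adj su e)
    ... | false | true  | ()
    ... | true  | false | ()

    sideLabel-class : ∀ x → P (λ v → sideLabel v ≡ x)
    sideLabel-class (inj₁ j) = P-resp (from sideLabel≡inj₁⇔ , to sideLabel≡inj₁⇔) (F.class j)
    sideLabel-class (inj₂ j) = P-resp (from sideLabel≡inj₂⇔ , to sideLabel≡inj₂⇔) (T.class j)

    component-labelling : Σ (Fin n → Fin (p + q)) λ comp →
                            IsComponentLabelling G (p + q) comp × (∀ i → P (λ v → comp v ≡ i))
    component-labelling = comp , labelling-by-connected-classes comp onto comp-adj class , class
      where
      comp : Fin n → Fin (p + q)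
      comp v = join p q (sideLabel v)
      onto : ∀ i → ∃[ v ] comp v ≡ i
      onto i = let (v , ℓv) = sideLabel-onto (splitAt p i) in v , from (join≡⇔≡splitAt p q) ℓv
      comp-adj : ∀ {u v} → Adj G u v → comp u ≡ comp v
      comp-adj e = cong (join p q) (sideLabel-adj e)
      class : ∀ i → P (λ v → comp v ≡ i)
      class i = P-resp (from (join≡⇔≡splitAt p q) , to (join≡⇔≡splitAt p q))
                       (sideLabel-class (splitAt p i))

module SplitBy {n : ℕ} (G : Graph n) (s : Fin n → Bool)
  (s-adj : ∀ {u v} → Adj G u v → s u ≡ s v) where

  alternative1 : ∀ {p q} → p + q ≡ 3 ⊎ p + q ≡ 4 →
    Partition G (λ v → s v ≡ false) p (CompleteOn G) →
    Partition G (λ v → s v ≡ true) q (CompleteOn G) → Alternative1 G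
  alternative1 {p} {q} size F T =
    p + q , size ,
    Union.component-labelling G (CompleteOn-resp G) (CompleteOn-connected G) s s-adj F T

  alternative2 : Partition G (λ v → s v ≡ false) 1 (CompleteOrP3ExpansionOn G) →
    Partition G (λ v → s v ≡ true) 1 (CompleteOrP3ExpansionOn G) → Alternative2 G
  alternative2 =
    Union.component-labelling G (CompleteOrP3ExpansionOn-resp G) (CompleteOrP3ExpansionOn-connected G)
                              s s-adj

-- Niche graphs of bipartite tournaments

both : ∀ {A B : Set} → A → B → A ⇔ B
both a b = mk⇔ (λ _ → b) (λ _ → a)

neither : ∀ {A B : Set} → ¬ A → ¬ B → A ⇔ B
neither ¬a ¬b = mk⇔ (λ a → ⊥-elim (¬a a)) (λ b → ⊥-elim (¬b b))

≡not⇒≢ : ∀ {x y} → x ≡ not y → x ≢ y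
≡not⇒≢ x≡¬y x≡y = not-¬ x≡y x≡¬y

≢not⇒≡ : ∀ {x y} → x ≢ not y → x ≡ y
≢not⇒≡ {y = y} x≢¬y = trans (¬-not x≢¬y) (not-involutive y)

both-≢⇒≡ : ∀ {x y z} → x ≢ z → y ≢ z → x ≡ y
both-≢⇒≡ x≢z y≢z = trans (¬-not x≢z) (sym (¬-not y≢z))

module NicheGraph {n : ℕ} (G : Graph n) (D : Digraph n) (tournament : IsBipartiteTournament D)
  (niche : IsNicheGraphOf G D) where
  open IsBipartiteTournament tournament

  OnSide : Bool → Pred (Fin n) 0ℓ
  OnSide σ v = side v ≡ σ

  inhabited : ∀ σ → ∃ (OnSide σ)
  inhabited false = partFalse
  inhabited true = partTrue

  across : ∀ σ → ∃[ w ] side w ≢ σ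
  across σ = let (w , w∈) = inhabited (not σ) in w , ≡not⇒≢ w∈

  arc? : ∀ u w → Dec (Arc D u w)
  arc? u w with side u ≟ᵇ side w
  ... | yes same = no (noArcInside u w same)
  ... | no differ with oriented u w differ
  ...   | inj₁ uw = yes uw
  ...   | inj₂ wu = no (antisym w u wu)

  out : Fin n → Fin n → Bool
  out u w = does (arc? u w)

  arc⇒out≡true : ∀ {u w} → Arc D u w → out u w ≡ true
  arc⇒out≡true {u} {w} = dec-true (arc? u w)

  reverse-arc⇒out≡false : ∀ {u w} → Arc D w u → out u w ≡ false
  reverse-arc⇒out≡false {u} {w} wu = dec-false (arc? u w) (antisym w u wu)

  out≡true⇒arc : ∀ {u w} → out u w ≡ true → Arc D u w
  out≡true⇒arc {u} {w} uw = decidable-stable (arc? u w) λ ¬uw → ≡not⇒≢ (dec-false (arc? u w) ¬uw) uw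

  out≡false⇒reverse-arc : ∀ {u w} → side u ≢ side w → out u w ≡ false → Arc D w u
  out≡false⇒reverse-arc {u} {w} differ ¬uw with oriented u w differ
  ... | inj₁ uw = ⊥-elim (≡not⇒≢ ¬uw (arc⇒out≡true uw))
  ... | inj₂ wu = wu

  out-antisym : ∀ {u w} → side u ≢ side w → out w u ≡ not (out u w)
  out-antisym {u} {w} differ with out u w in uw
  ... | true = reverse-arc⇒out≡false (out≡true⇒arc uw)
  ... | false = arc⇒out≡true (out≡false⇒reverse-arc differ uw)

  arc-crosses : ∀ {u w} → Arc D u w → side u ≢ side w
  arc-crosses {u} {w} uw same = noArcInside u w same uw

  crosses : ∀ {σ v w} → OnSide σ v → side w ≢ σ → side v ≢ side w
  crosses refl w∉ = ≢-sym w∉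

  adjacent⇒same-side : ∀ {u v} → Adj G u v → side u ≡ side v
  adjacent⇒same-side {u} {v} e with proj₂ (to (niche u v) e)
  ... | w , inj₁ (uw , vw) = both-≢⇒≡ (arc-crosses uw) (arc-crosses vw)
  ... | w , inj₂ (wu , wv) = both-≢⇒≡ (≢-sym (arc-crosses wu)) (≢-sym (arc-crosses wv))

  adjacent⇒agree : ∀ {σ u v} → OnSide σ u → Adj G u v → ∃[ w ] (side w ≢ σ × out u w ≡ out v w)
  adjacent⇒agree {u = u} {v} refl e with proj₂ (to (niche u v) e)
  ... | w , inj₁ (uw , vw) =
    w , ≢-sym (arc-crosses uw) , trans (arc⇒out≡true uw) (sym (arc⇒out≡true vw))
  ... | w , inj₂ (wu , wv) =
    w , arc-crosses wu , trans (reverse-arc⇒out≡false wu) (sym (reverse-arc⇒out≡false wv))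

  agree⇒adjacent : ∀ {σ u v w} → OnSide σ u → OnSide σ v → u ≢ v → side w ≢ σ →
                   out u w ≡ out v w → Adj G u v
  agree⇒adjacent {u = u} {v} {w} u∈ v∈ u≢v w∉ agree with out u w in uw
  ... | true = from (niche u v) (u≢v , w , inj₁ (out≡true⇒arc uw , out≡true⇒arc (sym agree)))
  ... | false = from (niche u v) (u≢v , w , inj₂ ( out≡false⇒reverse-arc (crosses u∈ w∉) uw
                                                  , out≡false⇒reverse-arc (crosses v∈ w∉) (sym agree)))

  adjacent? : ∀ u v → Dec (Adj G u v)
  adjacent? u v = map′ (from (niche u v)) (to (niche u v))
    (¬? (u ≟ᶠ v) ×-dec any? λ w → (arc? u w ×-dec arc? v w) ⊎-dec (arc? w u ×-dec arc? w v))

  -- σ is the part containing u and v; out u w is only meaningful for w outside it.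
  SameProfile OppositeProfile : Bool → Fin n → Fin n → Set
  SameProfile σ u v = ∀ w → side w ≢ σ → out u w ≡ out v w
  OppositeProfile σ u v = ∀ w → side w ≢ σ → out u w ≡ not (out v w)

  same? : ∀ σ u v → Dec (SameProfile σ u v)
  same? σ u v = all? λ w → ¬? (side w ≟ᵇ σ) →-dec (out u w ≟ᵇ out v w)

  module _ {σ : Bool} where

    same-refl : ∀ {u} → SameProfile σ u u
    same-refl _ _ = refl

    same-sym : ∀ {u v} → SameProfile σ u v → SameProfile σ v u
    same-sym uv w w∉ = sym (uv w w∉)

    same-trans : ∀ {u v x} → SameProfile σ u v → SameProfile σ v x → SameProfile σ u x
    same-trans uv vx w w∉ = trans (uv w w∉) (vx w w∉)

    opposite-sym : ∀ {u v} → OppositeProfile σ u v → OppositeProfile σ v u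
    opposite-sym {v = v} uv w w∉ = trans (sym (not-involutive (out v w))) (cong not (sym (uv w w∉)))

    same-opposite-trans : ∀ {u v x} → SameProfile σ u v → OppositeProfile σ v x → OppositeProfile σ u x
    same-opposite-trans uv vx w w∉ = trans (uv w w∉) (vx w w∉)

    opposite-same-trans : ∀ {u v x} → OppositeProfile σ u v → SameProfile σ v x → OppositeProfile σ u x
    opposite-same-trans uv vx w w∉ = trans (uv w w∉) (cong not (vx w w∉))

    opposite-opposite-trans : ∀ {u v x} → OppositeProfile σ u v → OppositeProfile σ v x → SameProfile σ u x
    opposite-opposite-trans {x = x} uv vx w w∉ =
      trans (uv w w∉) (trans (cong not (vx w w∉)) (not-involutive (out x w)))

    ¬same×opposite : ∀ {u v} → SameProfile σ u v → OppositeProfile σ u v → ⊥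
    ¬same×opposite uv u⊥v = let (w , w∉) = across σ in not-¬ (uv w w∉) (u⊥v w w∉)

    opposite⇒≢ : ∀ {u v} → OppositeProfile σ u v → u ≢ v
    opposite⇒≢ u⊥u refl = ¬same×opposite same-refl u⊥u

    same⇒adjacent : ∀ {u v} → OnSide σ u → OnSide σ v → u ≢ v → SameProfile σ u v → Adj G u v
    same⇒adjacent u∈ v∈ u≢v uv = let (w , w∉) = across σ in agree⇒adjacent u∈ v∈ u≢v w∉ (uv w w∉)

    opposite⇒¬adjacent : ∀ {u v} → OnSide σ u → OppositeProfile σ u v → ¬ Adj G u v
    opposite⇒¬adjacent u∈ u⊥v e = let (w , w∉ , agree) = adjacent⇒agree u∈ e in not-¬ agree (u⊥v w w∉)

    ¬adjacent⇒opposite : ∀ {u v} → OnSide σ u → OnSide σ v → u ≢ v → ¬ Adj G u v → OppositeProfile σ u v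
    ¬adjacent⇒opposite u∈ v∈ u≢v ¬uv w w∉ = ¬-not λ agree → ¬uv (agree⇒adjacent u∈ v∈ u≢v w∉ agree)

    ¬opposite⇒adjacent : ∀ {u v} → OnSide σ u → OnSide σ v → u ≢ v → ¬ OppositeProfile σ u v → Adj G u v
    ¬opposite⇒adjacent {u} {v} u∈ v∈ u≢v ¬u⊥v =
      decidable-stable (adjacent? u v) λ ¬uv → ¬u⊥v (¬adjacent⇒opposite u∈ v∈ u≢v ¬uv)

  Dichotomous : Bool → Set
  Dichotomous σ = ∀ {u v} → OnSide σ u → OnSide σ v → SameProfile σ u v ⊎ OppositeProfile σ u v

  OppositePair : Bool → Set
  OppositePair σ = Σ (Fin n) λ a → Σ (Fin n) λ b → OnSide σ a × OnSide σ b × OppositeProfile σ a b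

  dichotomous⇒adjacent-same : ∀ {σ u v} → Dichotomous σ → OnSide σ u → OnSide σ v → Adj G u v →
                              SameProfile σ u v
  dichotomous⇒adjacent-same dichotomous u∈ v∈ uv with dichotomous u∈ v∈
  ... | inj₁ same = same
  ... | inj₂ u⊥v = ⊥-elim (opposite⇒¬adjacent u∈ u⊥v uv)

  dichotomous⇒¬P3-expansion : ∀ {σ} → Dichotomous σ → ¬ ExpansionOn G (OnSide σ) P3
  dichotomous⇒¬P3-expansion dichotomous expansion =
    P3Expansion.¬adjacency-transitive G expansion λ a∈ b∈ c∈ ab bc a≢c →
      same⇒adjacent a∈ c∈ a≢c (same-trans (dichotomous⇒adjacent-same dichotomous a∈ b∈ ab)
                                          (dichotomous⇒adjacent-same dichotomous b∈ c∈ bc))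

  -- w has the profile of x or its complement, so out y w is out y x passed through id or not.
  out-relative-to : ∀ {σ x w} → Dichotomous σ → OnSide σ x → OnSide σ w →
    Σ (Bool → Bool) λ g → (∀ b → g (not b) ≡ not (g b)) ×
                          (∀ y → side y ≢ σ → out y w ≡ g (out y x))
  out-relative-to {x = x} {w} dichotomous x∈ w∈ with dichotomous w∈ x∈
  ... | inj₁ w≈x = (λ b → b) , (λ _ → refl) , λ y y∉ → begin
    out y w        ≡⟨ out-antisym (crosses w∈ y∉) ⟩
    not (out w y)  ≡⟨ cong not (w≈x y y∉) ⟩
    not (out x y)  ≡⟨ sym (out-antisym (crosses x∈ y∉)) ⟩
    out y x        ∎
    where open ≡-Reasoning
  ... | inj₂ w⊥x = not , (λ _ → refl) , λ y y∉ → begin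
    out y w              ≡⟨ out-antisym (crosses w∈ y∉) ⟩
    not (out w y)        ≡⟨ cong not (w⊥x y y∉) ⟩
    not (not (out x y))  ≡⟨ cong not (sym (out-antisym (crosses x∈ y∉))) ⟩
    not (out y x)        ∎
    where open ≡-Reasoning

  dichotomous-transfer : ∀ {σ} → Dichotomous σ → Dichotomous (not σ)
  dichotomous-transfer {σ} dichotomous = compare (proj₂ (inhabited σ))
    where
    open ≡-Reasoning
    compare : ∀ {x y c} → OnSide σ x → OnSide (not σ) y → OnSide (not σ) c →
              SameProfile (not σ) y c ⊎ OppositeProfile (not σ) y c
    compare {x} {y} {c} x∈ y∈ c∈ with out y x ≟ᵇ out c x
    ... | yes agree = inj₁ λ w w∉ →
      let (g , _ , via-x) = out-relative-to dichotomous x∈ (≢not⇒≡ w∉) in begin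
      out y w        ≡⟨ via-x y (≡not⇒≢ y∈) ⟩
      g (out y x)    ≡⟨ cong g agree ⟩
      g (out c x)    ≡⟨ sym (via-x c (≡not⇒≢ c∈)) ⟩
      out c w        ∎
    ... | no disagree = inj₂ λ w w∉ →
      let (g , g-not , via-x) = out-relative-to dichotomous x∈ (≢not⇒≡ w∉) in begin
      out y w              ≡⟨ via-x y (≡not⇒≢ y∈) ⟩
      g (out y x)          ≡⟨ cong g (¬-not disagree) ⟩
      g (not (out c x))    ≡⟨ g-not (out c x) ⟩
      not (g (out c x))    ≡⟨ cong not (sym (via-x c (≡not⇒≢ c∈))) ⟩
      not (out c w)        ∎

  two-cliques-partition : ∀ {σ} → Dichotomous σ → OppositePair σ →
                          Partition G (OnSide σ) 2 (CompleteOn G)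
  two-cliques-partition {σ} dichotomous (a , b , a∈ , b∈ , a⊥b) = record
    { label = label
    ; label-onto = λ { 0F → a , a∈ , label≡0F same-refl
                     ; 1F → b , b∈ , label≡1F λ ba →
                              ¬same×opposite same-refl (opposite-same-trans a⊥b ba) }
    ; label-adj = λ u∈ uv → same⇒label≡ (dichotomous⇒adjacent-same dichotomous u∈
                                          (trans (sym (adjacent⇒same-side uv)) u∈) uv)
    ; class = λ i u v (u∈ , ℓu) (v∈ , ℓv) u≢v →
        same⇒adjacent u∈ v∈ u≢v (label≡⇒same u∈ v∈ (trans ℓu (sym ℓv)))
    }
    where
    class-of : ∀ {u} → Dec (SameProfile σ u a) → Fin 2
    class-of (yes _) = 0F
    class-of (no _) = 1F
    label : Fin n → Fin 2
    label u = class-of (same? σ u a)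
    label≡0F : ∀ {u} → SameProfile σ u a → label u ≡ 0F
    label≡0F {u} ua with same? σ u a
    ... | yes _ = refl
    ... | no ¬ua = ⊥-elim (¬ua ua)
    label≡1F : ∀ {u} → ¬ SameProfile σ u a → label u ≡ 1F
    label≡1F {u} ¬ua with same? σ u a
    ... | yes ua = ⊥-elim (¬ua ua)
    ... | no _ = refl
    same⇒label≡ : ∀ {u v} → SameProfile σ u v → label u ≡ label v
    same⇒label≡ {u} {v} uv with same? σ v a
    ... | yes va = label≡0F (same-trans uv va)
    ... | no ¬va = label≡1F λ ua → ¬va (same-trans (same-sym uv) ua)
    label≡⇒same : ∀ {u v} → OnSide σ u → OnSide σ v → label u ≡ label v → SameProfile σ u v
    label≡⇒same {u} {v} u∈ v∈ ℓu≡ℓv with same? σ u a | same? σ v a | ℓu≡ℓv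
    ... | yes ua | yes va | _ = same-trans ua (same-sym va)
    ... | no ¬ua | no ¬va | _ =
      opposite-opposite-trans (opposite-of-a u∈ ¬ua) (opposite-sym (opposite-of-a v∈ ¬va))
      where
      opposite-of-a : ∀ {w} → OnSide σ w → ¬ SameProfile σ w a → OppositeProfile σ w a
      opposite-of-a w∈ ¬wa = [ (λ wa → ⊥-elim (¬wa wa)) , (λ w⊥a → w⊥a) ] (dichotomous w∈ a∈)
    ... | yes _ | no _ | ()
    ... | no _ | yes _ | ()

  data SideShape (σ : Bool) : Set where
    complete     : CompleteOn G (OnSide σ) → SideShape σ
    P3-expansion : ExpansionOn G (OnSide σ) P3 → SideShape σ
    two-cliques  : Dichotomous σ → OppositePair σ → SideShape σ

  module NonCompleteSide (chordal : Chordal G) {σ : Bool} {a b : Fin n}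
    (a∈ : OnSide σ a) (b∈ : OnSide σ b) (a⊥b : OppositeProfile σ a b) where

    near-a-near-b⇒opposite : ∀ {u v} → SameProfile σ u a → SameProfile σ v b → OppositeProfile σ u v
    near-a-near-b⇒opposite ua vb = same-opposite-trans ua (opposite-same-trans a⊥b (same-sym vb))

    Middle : Pred (Fin n) 0ℓ
    Middle c = OnSide σ c × ¬ SameProfile σ c a × ¬ SameProfile σ c b

    middle-adjacent-a : ∀ {c} → Middle c → Adj G c a
    middle-adjacent-a (c∈ , ¬ca , ¬cb) =
      ¬opposite⇒adjacent c∈ a∈ (λ { refl → ¬ca same-refl })
        λ c⊥a → ¬cb (opposite-opposite-trans c⊥a a⊥b)

    middle-adjacent-b : ∀ {c} → Middle c → Adj G c b
    middle-adjacent-b (c∈ , ¬ca , ¬cb) =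
      ¬opposite⇒adjacent c∈ b∈ (λ { refl → ¬cb same-refl })
        λ c⊥b → ¬ca (opposite-opposite-trans c⊥b (opposite-sym a⊥b))

    opposite-to-middle-is-middle : ∀ {c d} → Middle c → OnSide σ d → OppositeProfile σ c d → Middle d
    opposite-to-middle-is-middle (_ , ¬ca , ¬cb) d∈ c⊥d =
      d∈ , (λ da → ¬cb (opposite-opposite-trans (opposite-same-trans c⊥d da) a⊥b))
         , (λ db → ¬ca (opposite-opposite-trans (opposite-same-trans c⊥d db) (opposite-sym a⊥b)))

    -- Otherwise d is a middle vertex opposite to c, and a c b d is a chordless 4-cycle.
    middle-adjacent : ∀ {c d} → Middle c → OnSide σ d → c ≢ d → Adj G c d
    middle-adjacent {c} {d} mc d∈ c≢d = decidable-stable (adjacent? c d) λ ¬cd →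
      let md = opposite-to-middle-is-middle mc d∈ (¬adjacent⇒opposite (proj₁ mc) d∈ c≢d ¬cd) in
      [ opposite⇒¬adjacent a∈ a⊥b , ¬cd ]
        (chordal⇒square-has-diagonal G chordal (opposite⇒≢ a⊥b) c≢d
          (adj-sym G (middle-adjacent-a mc)) (middle-adjacent-b mc)
          (adj-sym G (middle-adjacent-b md)) (middle-adjacent-a md))

    data Position (u : Fin n) : Set where
      near-a  : SameProfile σ u a → Position u
      near-b  : SameProfile σ u b → Position u
      between : ¬ SameProfile σ u a → ¬ SameProfile σ u b → Position u

    position : ∀ u → Position u
    position u with same? σ u a | same? σ u b
    ... | yes ua | _ = near-a ua
    ... | no _ | yes ub = near-b ub
    ... | no ¬ua | no ¬ub = between ¬ua ¬ub

    index : ∀ {u} → Position u → Fin 3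
    index (near-a _) = 0F
    index (between _ _) = 1F
    index (near-b _) = 2F

    index-unique : ∀ {u} (p p′ : Position u) → index p ≡ index p′
    index-unique (near-a _) (near-a _) = refl
    index-unique (near-b _) (near-b _) = refl
    index-unique (between _ _) (between _ _) = refl
    index-unique (near-a ua) (near-b ub) = ⊥-elim (opposite⇒≢ (near-a-near-b⇒opposite ua ub) refl)
    index-unique (near-b ub) (near-a ua) = ⊥-elim (opposite⇒≢ (near-a-near-b⇒opposite ua ub) refl)
    index-unique (near-a ua) (between ¬ua _) = ⊥-elim (¬ua ua)
    index-unique (between ¬ua _) (near-a ua) = ⊥-elim (¬ua ua)
    index-unique (near-b ub) (between _ ¬ub) = ⊥-elim (¬ub ub)
    index-unique (between _ ¬ub) (near-b ub) = ⊥-elim (¬ub ub)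

    adjacent⇔ReflP3Adj : ∀ {u v} → OnSide σ u → OnSide σ v → u ≢ v →
                         (p : Position u) (p′ : Position v) → Adj G u v ⇔ ReflP3Adj (index p) (index p′)
    adjacent⇔ReflP3Adj u∈ v∈ u≢v (between ¬ua ¬ub) p′ =
      both (middle-adjacent (u∈ , ¬ua , ¬ub) v∈ u≢v) (ReflP3Adj-middle (index p′))
    adjacent⇔ReflP3Adj u∈ v∈ u≢v p (between ¬va ¬vb) =
      both (adj-sym G (middle-adjacent (v∈ , ¬va , ¬vb) u∈ (≢-sym u≢v)))
           (ReflP3Adj-sym (ReflP3Adj-middle (index p)))
    adjacent⇔ReflP3Adj u∈ v∈ u≢v (near-a ua) (near-a va) =
      both (same⇒adjacent u∈ v∈ u≢v (same-trans ua (same-sym va))) (inj₁ refl)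
    adjacent⇔ReflP3Adj u∈ v∈ u≢v (near-b ub) (near-b vb) =
      both (same⇒adjacent u∈ v∈ u≢v (same-trans ub (same-sym vb))) (inj₁ refl)
    adjacent⇔ReflP3Adj u∈ v∈ u≢v (near-a ua) (near-b vb) =
      neither (opposite⇒¬adjacent u∈ (near-a-near-b⇒opposite ua vb)) ¬ReflP3Adj-ends
    adjacent⇔ReflP3Adj u∈ v∈ u≢v (near-b ub) (near-a va) =
      neither (opposite⇒¬adjacent u∈ (opposite-sym (near-a-near-b⇒opposite va ub)))
              (λ r → ¬ReflP3Adj-ends (ReflP3Adj-sym r))

    middle⇒P3-expansion : ∀ {c} → Middle c → ExpansionOn G (OnSide σ) P3
    middle⇒P3-expansion {c} (c∈ , ¬ca , ¬cb) =
      (λ u → index (position u)) , onto ,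
      λ u v u∈ v∈ u≢v → adjacent⇔ReflP3Adj u∈ v∈ u≢v (position u) (position v)
      where
      onto : ∀ t → ∃[ v ] (OnSide σ v × index (position v) ≡ t)
      onto 0F = a , a∈ , index-unique (position a) (near-a same-refl)
      onto 1F = c , c∈ , index-unique (position c) (between ¬ca ¬cb)
      onto 2F = b , b∈ , index-unique (position b) (near-b same-refl)

    no-middle⇒dichotomous : ¬ ∃ Middle → Dichotomous σ
    no-middle⇒dichotomous ∄middle {u} {v} u∈ v∈ = compare (position u) (position v)
      where
      compare : Position u → Position v → SameProfile σ u v ⊎ OppositeProfile σ u v
      compare (between ¬ua ¬ub) _ = ⊥-elim (∄middle (u , u∈ , ¬ua , ¬ub))
      compare _ (between ¬va ¬vb) = ⊥-elim (∄middle (v , v∈ , ¬va , ¬vb))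
      compare (near-a ua) (near-a va) = inj₁ (same-trans ua (same-sym va))
      compare (near-b ub) (near-b vb) = inj₁ (same-trans ub (same-sym vb))
      compare (near-a ua) (near-b vb) = inj₂ (near-a-near-b⇒opposite ua vb)
      compare (near-b ub) (near-a va) = inj₂ (opposite-sym (near-a-near-b⇒opposite va ub))

    shape : SideShape σ
    shape with any? (λ c → (side c ≟ᵇ σ) ×-dec ¬? (same? σ c a) ×-dec ¬? (same? σ c b))
    ... | yes (_ , mc) = P3-expansion (middle⇒P3-expansion mc)
    ... | no ∄middle = two-cliques (no-middle⇒dichotomous ∄middle) (a , b , a∈ , b∈ , a⊥b)

  classify : Chordal G → ∀ σ → SideShape σ
  classify chordal σ with any? (λ a → any? λ b →
    (side a ≟ᵇ σ) ×-dec (side b ≟ᵇ σ) ×-dec ¬? (a ≟ᶠ b) ×-dec ¬? (adjacent? a b))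
  ... | yes (a , b , a∈ , b∈ , a≢b , ¬ab) =
    NonCompleteSide.shape chordal a∈ b∈ (¬adjacent⇒opposite a∈ b∈ a≢b ¬ab)
  ... | no ∄nonadjacent = complete λ u v u∈ v∈ u≢v →
    decidable-stable (adjacent? u v) λ ¬uv → ∄nonadjacent (u , v , u∈ , v∈ , u≢v , ¬uv)

  complete-side-partition : ∀ {σ} → CompleteOn G (OnSide σ) →
                            Partition G (OnSide σ) 1 (CompleteOn G)
  complete-side-partition = single-part G (CompleteOn-resp G) (inhabited _)

  complete-or-P3-side-partition : ∀ {σ} → CompleteOrP3ExpansionOn G (OnSide σ) →
                                  Partition G (OnSide σ) 1 (CompleteOrP3ExpansionOn G)
  complete-or-P3-side-partition = single-part G (CompleteOrP3ExpansionOn-resp G) (inhabited _)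

  open SplitBy G side adjacent⇒same-side

  two-components : CompleteOrP3ExpansionOn G (OnSide false) → CompleteOrP3ExpansionOn G (OnSide true) →
                   Alternative2 G
  two-components shapeF shapeT =
    alternative2 (complete-or-P3-side-partition shapeF) (complete-or-P3-side-partition shapeT)

  chordal⇒alternatives : Chordal G → Alternative1 G ⊎ Alternative2 G
  chordal⇒alternatives chordal with classify chordal false | classify chordal true
  ... | two-cliques dF pF | two-cliques dT pT =
    inj₁ (alternative1 (inj₂ refl) (two-cliques-partition dF pF) (two-cliques-partition dT pT))
  ... | complete kF | two-cliques dT pT =
    inj₁ (alternative1 (inj₁ refl) (complete-side-partition kF) (two-cliques-partition dT pT))
  ... | two-cliques dF pF | complete kT =
    inj₁ (alternative1 (inj₁ refl) (two-cliques-partition dF pF) (complete-side-partition kT))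
  ... | two-cliques dF _ | P3-expansion eT =
    ⊥-elim (dichotomous⇒¬P3-expansion (dichotomous-transfer dF) eT)
  ... | P3-expansion eF | two-cliques dT _ =
    ⊥-elim (dichotomous⇒¬P3-expansion (dichotomous-transfer dT) eF)
  ... | complete kF     | complete kT     = inj₂ (two-components (inj₁ kF) (inj₁ kT))
  ... | complete kF     | P3-expansion eT = inj₂ (two-components (inj₁ kF) (inj₂ eT))
  ... | P3-expansion eF | complete kT     = inj₂ (two-components (inj₂ eF) (inj₁ kT))
  ... | P3-expansion eF | P3-expansion eT = inj₂ (two-components (inj₂ eF) (inj₂ eT))

proposition4p3 : ∀ {n : ℕ} (G : Graph n) → NicheRealizable G →
    (Chordal G ⇔ (Alternative1 G ⊎ Alternative2 G))
proposition4p3 G (D , tournament , niche) =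
  mk⇔ (NicheGraph.chordal⇒alternatives G D tournament niche) (alternatives⇒chordal G)
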